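{- If a graph $G$ contains two edge-disjoint cycles that have exactly one vertex in common, then $d_g'(S(G))=1$.
   Context: All graphs are finite and simple. The subdivision graph $S(G)$ is obtained from $G$ by replacing each edge $uv$ by a new vertex adjacent to exactly $u$ and $v$. For a vertex $x$, $N[x]$ denotes its closed neighborhood. The domatic number game on a graph $H$ with palette $[k]=\{1,\dots,k\}$: two players, Alice and Bob, alternately choose a previously unchosen vertex of $H$ and assign it a color from $[k]$, until every vertex has been colored. Let $V_i$ be the set of vertices colored $i$. Alice wins if every $V_i$ ($i\in[k]$) is a dominating set of $H$, i.e. for every vertex $x$ and every color $c\in[k]$ some vertex of $N[x]$ has color $c$; otherwise Bob wins. In the $B$-game Bob moves first. The delayed game domatic number $d_g'(H)$ is the largest $k$ for which Alice has a winning strategy in the $B$-game with palette $[k]$. -}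

module Defs where

open import Data.Nat using (ℕ; zero; suc; _<_; _≤_)
open import Data.Fin using (Fin; zero; suc; inject₁; fromℕ)
open import Data.Maybe using (Maybe; just; nothing)
open import Data.Product using (Σ; ∃; ∃-syntax; _×_; _,_; proj₁; proj₂)
open import Data.Sum using (_⊎_; inj₁; inj₂)
open import Data.Sum.Properties using (≡-dec)
open import Data.Fin.Properties using (_≟_)
open import Data.Empty using (⊥)
open import Data.Bool using (if_then_else_)
open import Relation.Nullary using (¬_; does)
open import Relation.Binary.PropositionalEquality using (_≡_; _≢_)
open import Relation.Binary.Definitions using (DecidableEquality)
open import Function.Definitions using (Injective)

record Graph : Set where
  field
    n : ℕ
    m : ℕ
    ends : Fin m → Fin n × Fin n
    loopless : ∀ e → proj₁ (ends e) ≢ proj₂ (ends e)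
    simple : ∀ e f →
      ((proj₁ (ends e) ≡ proj₁ (ends f)) × (proj₂ (ends e) ≡ proj₂ (ends f)))
      ⊎ ((proj₁ (ends e) ≡ proj₂ (ends f)) × (proj₂ (ends e) ≡ proj₁ (ends f)))
      → e ≡ f

open Graph public

Joins : (G : Graph) → Fin (m G) → Fin (n G) → Fin (n G) → Set
Joins G e u v =
  ((proj₁ (ends G e) ≡ u) × (proj₂ (ends G e) ≡ v))
  ⊎ ((proj₁ (ends G e) ≡ v) × (proj₂ (ends G e) ≡ u))

Adj : (G : Graph) → Fin (n G) → Fin (n G) → Set
Adj G u v = ∃[ e ] Joins G e u v

-- Cycles: a cycle of length suc l (with l ≥ 2, i.e. length ≥ 3) is an
-- injective sequence of vertices v₀ … v_l with v_i v_{i+1} and v_l v₀ edges.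

record Cycle (G : Graph) : Set where
  field
    l : ℕ
    len≥3 : 2 ≤ l
    vtx : Fin (suc l) → Fin (n G)
    distinct : Injective _≡_ _≡_ vtx
    step : ∀ (i : Fin l) → Adj G (vtx (inject₁ i)) (vtx (suc i))
    close : Adj G (vtx (fromℕ l)) (vtx zero)

open Cycle public

OnCycle : {G : Graph} → Cycle G → Fin (n G) → Set
OnCycle C v = ∃[ i ] vtx C i ≡ v

CycEdge : {G : Graph} → Cycle G → Fin (n G) → Fin (n G) → Set
CycEdge C u v =
  (∃[ i ] (vtx C (inject₁ i) ≡ u × vtx C (suc i) ≡ v))
  ⊎ (vtx C (fromℕ (l C)) ≡ u × vtx C zero ≡ v)

EdgeDisjoint : {G : Graph} → Cycle G → Cycle G → Set
EdgeDisjoint C D = ∀ u v → CycEdge C u v → ¬ (CycEdge D u v ⊎ CycEdge D v u)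

ExactlyOneCommon : {G : Graph} → Cycle G → Cycle G → Set
ExactlyOneCommon C D =
  ∃[ w ] (OnCycle C w × OnCycle D w × (∀ x → OnCycle C x → OnCycle D x → x ≡ w))

record DGraph : Set₁ where
  field
    V : Set
    _≟V_ : DecidableEquality V
    E : V → V → Set

open DGraph public

-- Subdivision graph S(G): vertices are the old vertices (inj₁) and one new
-- vertex per edge (inj₂); the edge-vertex e is adjacent exactly to the two
-- endpoints of e.
SAdj : (G : Graph) → Fin (n G) ⊎ Fin (m G) → Fin (n G) ⊎ Fin (m G) → Set
SAdj G (inj₁ v) (inj₁ w) = ⊥
SAdj G (inj₁ v) (inj₂ e) = proj₁ (ends G e) ≡ v ⊎ proj₂ (ends G e) ≡ v
SAdj G (inj₂ e) (inj₁ v) = proj₁ (ends G e) ≡ v ⊎ proj₂ (ends G e) ≡ v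
SAdj G (inj₂ e) (inj₂ f) = ⊥

S : Graph → DGraph
S G = record { V = Fin (n G) ⊎ Fin (m G) ; _≟V_ = ≡-dec _≟_ _≟_ ; E = SAdj G }

-- The domatic number game with palette Fin k (colors 1..k ↦ Fin k).

data Player : Set where
  alice bob : Player

module Game (H : DGraph) (k : ℕ) where
  Colouring : Set
  Colouring = V H → Maybe (Fin k)

  update : Colouring → V H → Fin k → Colouring
  update c v a w = if does ((_≟V_ H) w v) then just a else c w

  Complete : Colouring → Set
  Complete c = ∀ v → ∃[ a ] c v ≡ just a

  AllDominating : Colouring → Set
  AllDominating c = ∀ (x : V H) (a : Fin k) →
    ∃[ y ] ((y ≡ x ⊎ E H x y) × c y ≡ just a)

  data AliceWins (c : Colouring) : Player → Set where
    finished : ∀ {p} → Complete c → AllDominating c → AliceWins c p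
    aliceMove : (v : V H) → c v ≡ nothing → (a : Fin k) →
                AliceWins (update c v a) bob → AliceWins c alice
    bobMove : (∃[ v ] c v ≡ nothing) →
              (∀ v → c v ≡ nothing → ∀ (a : Fin k) →
                 AliceWins (update c v a) alice) →
              AliceWins c bob

  -- Alice wins the B-game (Bob moves first from the empty colouring)
  AliceWinsB : Set
  AliceWinsB = AliceWins (λ _ → nothing) bob

-- d is the delayed game domatic number d_g'(H): the largest k for which
-- Alice wins the B-game with palette [k].
IsDg' : DGraph → ℕ → Set
IsDg' H d = Game.AliceWinsB H d × (∀ k → d < k → ¬ Game.AliceWinsB H k)

module Submission where

-- With a single colour every complete colouring is dominating, so Alice wins however the game goes.
-- With colours 0, 1, … Bob first colours the common vertex w with 0. Alice's reply lies on (the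
-- subdivision of) at most one of the two cycles, so Bob can walk around the other one, colouring
-- its vertices 0 one after another. Each such move threatens the subdivision vertex of the edge
-- just completed: if Bob coloured it 0 as well, its closed neighbourhood would miss colour 1. So
-- Alice must answer there, and when Bob colours the last vertex before w he makes two threats at once.

open import Defs
open import Data.Product using (∃; ∃-syntax; _×_; _,_; proj₁; proj₂)
open import Data.Sum as Sum using (_⊎_; inj₁; inj₂)
open import Data.Sum.Properties using (inj₁-injective; inj₂-injective)
open import Data.Empty using (⊥)
open import Data.Nat as ℕ using (ℕ; zero; suc; s≤s; z≤n)
import Data.Nat.Properties as ℕ
open import Data.Fin using (Fin; zero; suc; inject₁; fromℕ; _≤_; _<_)
open import Data.Fin.Properties as Fin
  using (0≢1+n; fromℕ≢inject₁; inject₁-injective; suc-injective; ≤̄⇒inject₁<; <⇒≢)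
open import Data.Fin.Induction using (>-weakInduction)
open import Data.Maybe using (just; nothing)
import Data.Maybe.Properties as Maybe
open import Data.List using (List; []; length; filter; map; _++_; allFin)
open import Data.List.Properties using (filter-notAll)
open import Data.List.Membership.Propositional using (_∈_; lose)
open import Data.List.Membership.Propositional.Properties
  using (∈-filter⁺; ∈-++⁺ˡ; ∈-++⁺ʳ; ∈-map⁺; ∈-allFin)
open import Data.List.Relation.Unary.Any using (any?; satisfied)
open import Function using (_∘_)
open import Relation.Nullary using (yes; no; ¬_; ¬?)
open import Relation.Nullary.Negation using (contradiction)
open import Relation.Binary.PropositionalEquality using (_≡_; _≢_; refl; sym; trans; cong; subst)

module Moves (H : DGraph) (k : ℕ) where
  open Game H k

  update-≡ : ∀ c v a → update c v a v ≡ just a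
  update-≡ c v a with _≟V_ H v v
  ... | yes _ = refl
  ... | no v≢v = contradiction refl v≢v

  update-≢ : ∀ c v a {w} → w ≢ v → update c v a w ≡ c w
  update-≢ c v a {w} w≢v with _≟V_ H w v
  ... | yes w≡v = contradiction w≡v w≢v
  ... | no _ = refl

  update-nothing : ∀ c v a {w} → update c v a w ≡ nothing → w ≢ v × c w ≡ nothing
  update-nothing c v a {w} eq with _≟V_ H w v
  ... | no w≢v = w≢v , eq

  empty : Colouring
  empty _ = nothing

  _⊑_ : Colouring → Colouring → Set
  c ⊑ d = ∀ {v a} → c v ≡ just a → d v ≡ just a

  update-⊒ : ∀ c v a → c v ≡ nothing → c ⊑ update c v a
  update-⊒ c v a cv≡nothing {w} cw≡just = trans (update-≢ c v a w≢v) cw≡just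
    where
    w≢v : w ≢ v
    w≢v refl with () ← trans (sym cv≡nothing) cw≡just

  winsAfterBobMove : ∀ {c v} → AliceWins c bob → c v ≡ nothing →
                     ∀ a → AliceWins (update c v a) alice
  winsAfterBobMove {v = v} (finished complete _) cv≡nothing a with complete v
  ... | _ , cv≡just with () ← trans (sym cv≡nothing) cv≡just
  winsAfterBobMove (bobMove _ reply) cv≡nothing a = reply _ cv≡nothing a

  winningReply : ∀ {c v} → AliceWins c alice → c v ≡ nothing →
                 ∃[ u ] ∃[ a ] (c u ≡ nothing × AliceWins (update c u a) bob)
  winningReply {v = v} (finished complete _) cv≡nothing with complete v
  ... | _ , cv≡just with () ← trans (sym cv≡nothing) cv≡just
  winningReply (aliceMove u cu≡nothing a wins) _ = u , a , cu≡nothing , wins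

module FiniteGame (H : DGraph) (k : ℕ) (vertices : List (V H)) (∈-vertices : ∀ v → v ∈ vertices)
  where
  open Game H (suc k)
  open Moves H (suc k)

  complete-or-uncoloured : ∀ c → Complete c ⊎ ∃[ v ] c v ≡ nothing
  complete-or-uncoloured c with any? (λ v → Maybe.≡-dec Fin._≟_ (c v) nothing) vertices
  ... | yes some = inj₂ (satisfied some)
  ... | no none = inj₁ coloured
    where
    coloured : Complete c
    coloured v with c v in cv
    ... | just a = a , refl
    ... | nothing = contradiction (lose (∈-vertices v) cv) none

  module _ (dominating : ∀ c → Complete c → AllDominating c) where

    -- Termination: every move removes its vertex from a list covering the uncoloured vertices.
    winsWithin : ∀ bound (L : List (V H)) → length L ℕ.≤ bound →
                 ∀ c p → (∀ {v} → c v ≡ nothing → v ∈ L) → AliceWins c p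
    winsWithin bound L |L|≤bound c p covers with complete-or-uncoloured c
    ... | inj₁ complete = finished complete (dominating c complete)
    winsWithin zero [] _ c p covers | inj₂ (v , cv≡nothing) with () ← covers cv≡nothing
    winsWithin (suc bound) L |L|≤bound c p covers | inj₂ (v , cv≡nothing) = play p
      where
      without : V H → List (V H)
      without u = filter (λ x → ¬? (_≟V_ H x u)) L

      shorter : ∀ {u} → c u ≡ nothing → length (without u) ℕ.≤ bound
      shorter {u} cu≡nothing = ℕ.s≤s⁻¹ (ℕ.<-≤-trans |without|<|L| |L|≤bound)
        where
        |without|<|L| : length (without u) ℕ.< length L
        |without|<|L| = filter-notAll _ L (lose (covers cu≡nothing) λ u≢u → u≢u refl)

      continue : ∀ {u} → c u ≡ nothing → ∀ a q → AliceWins (update c u a) q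
      continue {u} cu≡nothing a q = winsWithin bound (without u) (shorter cu≡nothing) _ q covers′
        where
        covers′ : ∀ {x} → update c u a x ≡ nothing → x ∈ without u
        covers′ eq with update-nothing c u a eq
        ... | x≢u , cx≡nothing = ∈-filter⁺ _ (covers cx≡nothing) x≢u

      play : ∀ q → AliceWins c q
      play alice = aliceMove v cv≡nothing zero (continue cv≡nothing zero bob)
      play bob = bobMove (v , cv≡nothing) λ u cu≡nothing a → continue cu≡nothing a alice

    aliceWins : ∀ c p → AliceWins c p
    aliceWins c p = winsWithin _ vertices ℕ.≤-refl c p λ {v} _ → ∈-vertices v

complete⇒allDominating : ∀ H → let open Game H 1 in ∀ c → Complete c → AllDominating c
complete⇒allDominating H c complete x zero with complete x
... | zero , cx≡just = x , inj₁ refl , cx≡just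

-- Bob colours with zero and attacks the colour suc zero.
module Threats (H : DGraph) (k : ℕ) where
  open Game H (suc (suc k))
  open Moves H (suc (suc k))

  Monochromatic : Colouring → V H → Set
  Monochromatic c x = ∀ y → y ≡ x ⊎ E H x y → c y ≡ just zero

  Threat : Colouring → V H → Set
  Threat c x = c x ≡ nothing × (∀ y → E H x y → c y ≡ just zero)

  monochromatic⇒¬allDominating : ∀ {c x} → Monochromatic c x → ¬ AllDominating c
  monochromatic⇒¬allDominating {c} {x} mono dominating with dominating x (suc zero)
  ... | y , y∈N[x] , cy≡just with () ← trans (sym (mono y y∈N[x])) cy≡just

  ¬wins-monochromatic : ∀ {c p x} → AliceWins c p → ¬ Monochromatic c x
  ¬wins-monochromatic (finished _ dominating) mono = monochromatic⇒¬allDominating mono dominating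
  ¬wins-monochromatic (aliceMove v cv≡nothing a wins) mono =
    ¬wins-monochromatic wins λ y y∈N[x] → update-⊒ _ v a cv≡nothing (mono y y∈N[x])
  ¬wins-monochromatic (bobMove (v , cv≡nothing) reply) mono =
    ¬wins-monochromatic (reply v cv≡nothing zero) λ y y∈N[x] →
      update-⊒ _ v zero cv≡nothing (mono y y∈N[x])

  threat-update : ∀ {c x v} a → c v ≡ nothing → x ≢ v → Threat c x → Threat (update c v a) x
  threat-update {c} {x} {v} a cv≡nothing x≢v (cx≡nothing , attacked) =
    trans (update-≢ c v a x≢v) cx≡nothing , λ y xy → update-⊒ c v a cv≡nothing (attacked y xy)

  ¬wins-threat : ∀ {c x} → AliceWins c bob → ¬ Threat c x
  ¬wins-threat {c} {x} wins (cx≡nothing , attacked) =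
    ¬wins-monochromatic (winsAfterBobMove wins cx≡nothing zero) monochromatic
    where
    monochromatic : Monochromatic (update c x zero) x
    monochromatic y (inj₁ refl) = update-≡ c x zero
    monochromatic y (inj₂ xy) = update-⊒ c x zero cx≡nothing (attacked y xy)

  answerThreat : ∀ {c x} → AliceWins c alice → Threat c x → ∃[ a ] AliceWins (update c x a) bob
  answerThreat {x = x} (finished complete _) (cx≡nothing , _) with complete x
  ... | _ , cx≡just with () ← trans (sym cx≡nothing) cx≡just
  answerThreat {x = x} (aliceMove v cv≡nothing a wins) threat with _≟V_ H v x
  ... | yes refl = a , wins
  ... | no v≢x = contradiction (threat-update a cv≡nothing (v≢x ∘ sym) threat) (¬wins-threat wins)

  ¬wins-doubleThreat : ∀ {c x y} → AliceWins c alice → x ≢ y → Threat c x → Threat c y → ⊥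
  ¬wins-doubleThreat wins x≢y threat-x threat-y with answerThreat wins threat-x
  ... | a , wins′ = ¬wins-threat wins′ (threat-update a (proj₁ threat-x) (x≢y ∘ sym) threat-y)

module Cycles (G : Graph) where

  joins-unique : ∀ {e u v u′ v′} → Joins G e u v → Joins G e u′ v′ →
                 (u′ ≡ u × v′ ≡ v) ⊎ (u′ ≡ v × v′ ≡ u)
  joins-unique (inj₁ (refl , refl)) (inj₁ (refl , refl)) = inj₁ (refl , refl)
  joins-unique (inj₁ (refl , refl)) (inj₂ (refl , refl)) = inj₂ (refl , refl)
  joins-unique (inj₂ (refl , refl)) (inj₁ (refl , refl)) = inj₂ (refl , refl)
  joins-unique (inj₂ (refl , refl)) (inj₂ (refl , refl)) = inj₁ (refl , refl)

  Consecutive : ∀ {L} → (Fin (suc L) → Fin (n G)) → Fin (n G) → Fin (n G) → Set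
  Consecutive {L} f u v =
    (∃[ i ] (f (inject₁ i) ≡ u × f (suc i) ≡ v)) ⊎ (f (fromℕ L) ≡ u × f zero ≡ v)

  record IsCycle {L} (f : Fin (suc L) → Fin (n G)) : Set where
    field
      injective : ∀ {i j} → f i ≡ f j → i ≡ j
      adj-step : ∀ i → Adj G (f (inject₁ i)) (f (suc i))
      adj-close : Adj G (f (fromℕ L)) (f zero)

  cycle-isCycle : (C : Cycle G) → IsCycle (vtx C)
  cycle-isCycle C = record { injective = distinct C ; adj-step = step C ; adj-close = close C }

  Touches : ∀ {L} → (Fin (suc L) → Fin (n G)) → Fin (n G) ⊎ Fin (m G) → Set
  Touches f (inj₁ x) = ∃[ i ] f i ≡ x
  Touches f (inj₂ e) = ∃[ u ] ∃[ v ] (Consecutive f u v × Joins G e u v)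

  Rerooting : ∀ {L} → (Fin (suc L) → Fin (n G)) → Fin (n G) → Set
  Rerooting {L} f w =
    ∃ λ (g : Fin (suc L) → Fin (n G)) →
      IsCycle g × g zero ≡ w × (∀ x → Touches g x → Touches f x)

  cyclicPred : ∀ {L} → Fin (suc L) → Fin (suc L)
  cyclicPred zero = fromℕ _
  cyclicPred (suc i) = inject₁ i

  isCycle-∘cyclicPred : ∀ {L} {f : Fin (suc L) → Fin (n G)} → IsCycle f → IsCycle (f ∘ cyclicPred)
  isCycle-∘cyclicPred {zero} cyc = record
    { injective = λ { {zero} {zero} _ → refl }
    ; adj-step = λ ()
    ; adj-close = IsCycle.adj-close cyc
    }
  isCycle-∘cyclicPred {suc L} {f} cyc = record
    { injective = cyclicPred-injective ∘ IsCycle.injective cyc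
    ; adj-step = adj-step
    ; adj-close = IsCycle.adj-step cyc (fromℕ L)
    }
    where
    cyclicPred-injective : ∀ {i j : Fin (suc (suc L))} → cyclicPred i ≡ cyclicPred j → i ≡ j
    cyclicPred-injective {zero} {zero} _ = refl
    cyclicPred-injective {zero} {suc j} eq = contradiction eq fromℕ≢inject₁
    cyclicPred-injective {suc i} {zero} eq = contradiction (sym eq) fromℕ≢inject₁
    cyclicPred-injective {suc i} {suc j} eq = cong suc (inject₁-injective eq)

    adj-step : ∀ i → Adj G (f (cyclicPred (inject₁ i))) (f (cyclicPred (suc i)))
    adj-step zero = IsCycle.adj-close cyc
    adj-step (suc i) = IsCycle.adj-step cyc (inject₁ i)

  consecutive-∘cyclicPred : ∀ {L} (f : Fin (suc L) → Fin (n G)) {u v} →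
                            Consecutive (f ∘ cyclicPred) u v → Consecutive f u v
  consecutive-∘cyclicPred f (inj₁ (zero , eqs)) = inj₂ eqs
  consecutive-∘cyclicPred f (inj₁ (suc i , eqs)) = inj₁ (inject₁ i , eqs)
  consecutive-∘cyclicPred {zero} f (inj₂ eqs) = inj₂ eqs
  consecutive-∘cyclicPred {suc L} f (inj₂ eqs) = inj₁ (fromℕ L , eqs)

  touches-∘cyclicPred : ∀ {L} (f : Fin (suc L) → Fin (n G)) x →
                        Touches (f ∘ cyclicPred) x → Touches f x
  touches-∘cyclicPred f (inj₁ x) (i , eq) = cyclicPred i , eq
  touches-∘cyclicPred f (inj₂ e) (u , v , uv , joins) = u , v , consecutive-∘cyclicPred f uv , joins

  rerooting : ∀ {L} (f : Fin (suc L) → Fin (n G)) → IsCycle f → ∀ i → Rerooting f (f i)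
  rerooting {L} f cyc i = >-weakInduction Rerootable last previous i f cyc
    where
    Rerootable : Fin (suc L) → Set
    Rerootable i = ∀ (f : Fin (suc L) → Fin (n G)) → IsCycle f → Rerooting f (f i)

    last : Rerootable (fromℕ L)
    last f cyc = f ∘ cyclicPred , isCycle-∘cyclicPred cyc , refl , touches-∘cyclicPred f

    previous : ∀ i → Rerootable (suc i) → Rerootable (inject₁ i)
    previous i rerootable f cyc with rerootable (f ∘ cyclicPred) (isCycle-∘cyclicPred cyc)
    ... | g , cyc-g , g0≡ , g⊆ = g , cyc-g , g0≡ , λ x → touches-∘cyclicPred f x ∘ g⊆ x

module Attack (G : Graph) (k : ℕ) where
  open Game (S G) (suc (suc k))
  open Moves (S G) (suc (suc k))
  open Threats (S G) k
  open Cycles G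

  neighbour-endpoint : ∀ {e u v z} → Joins G e u v → SAdj G (inj₂ e) (inj₁ z) → z ≡ u ⊎ z ≡ v
  neighbour-endpoint (inj₁ (refl , refl)) (inj₁ refl) = inj₁ refl
  neighbour-endpoint (inj₁ (refl , refl)) (inj₂ refl) = inj₂ refl
  neighbour-endpoint (inj₂ (refl , refl)) (inj₁ refl) = inj₂ refl
  neighbour-endpoint (inj₂ (refl , refl)) (inj₂ refl) = inj₁ refl

  edgeThreat : ∀ {c e u v} → Joins G e u v → c (inj₁ u) ≡ just zero → c (inj₁ v) ≡ just zero →
               c (inj₂ e) ≡ nothing → Threat c (inj₂ e)
  edgeThreat {c} joins cu≡zero cv≡zero ce≡nothing = ce≡nothing , attacked
    where
    attacked : ∀ y → SAdj G (inj₂ _) y → c y ≡ just zero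
    attacked (inj₁ z) adj with neighbour-endpoint joins adj
    ... | inj₁ refl = cu≡zero
    ... | inj₂ refl = cv≡zero

  Fresh : ∀ {L} → (Fin (suc L) → Fin (n G)) → Fin (n G) → Colouring → Set
  Fresh f w c = c (inj₁ w) ≡ just zero × (∀ x → Touches f x → x ≢ inj₁ w → c x ≡ nothing)

  EdgesFree : ∀ {L} → (Fin (suc L) → Fin (n G)) → Colouring → Set
  EdgesFree f c = ∀ {e u v} → Consecutive f u v → Joins G e u v →
                  c (inj₁ u) ≡ nothing ⊎ c (inj₁ v) ≡ nothing → c (inj₂ e) ≡ nothing

  edgesFree-vertexMove : ∀ {L} {f : Fin (suc L) → Fin (n G)} {c x} a →
                         c (inj₁ x) ≡ nothing → EdgesFree f c → EdgesFree f (update c (inj₁ x) a)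
  edgesFree-vertexMove {c = c} {x} a cx≡nothing free uv joins endpoint≡nothing =
    trans (update-≢ c (inj₁ x) a λ ()) (free uv joins (Sum.map uncoloured uncoloured endpoint≡nothing))
    where
    uncoloured : ∀ {y} → update c (inj₁ x) a y ≡ nothing → c y ≡ nothing
    uncoloured = proj₂ ∘ update-nothing c (inj₁ x) a

  edgesFree-edgeMove : ∀ {L} {f : Fin (suc L) → Fin (n G)} {c g u v} a →
                       Joins G g u v → c (inj₁ u) ≡ just zero → c (inj₁ v) ≡ just zero →
                       EdgesFree f c → EdgesFree f (update c (inj₂ g) a)
  edgesFree-edgeMove {c = c} {g} a joins-g cu≡zero cv≡zero free {e} {u′} {v′} uv joins-e
                     endpoint≡nothing =
    trans (update-≢ c (inj₂ g) a e≢g) (free uv joins-e endpoint≡nothing′)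
    where
    unchanged : ∀ {y} → update c (inj₂ g) a (inj₁ y) ≡ c (inj₁ y)
    unchanged = update-≢ c (inj₂ g) a λ ()

    endpoint≡nothing′ : c (inj₁ u′) ≡ nothing ⊎ c (inj₁ v′) ≡ nothing
    endpoint≡nothing′ = Sum.map (trans (sym unchanged)) (trans (sym unchanged)) endpoint≡nothing

    e≢g : inj₂ e ≢ inj₂ g
    e≢g refl with joins-unique joins-g joins-e | endpoint≡nothing′
    ... | inj₁ (refl , _) | inj₁ cu≡nothing with () ← trans (sym cu≡zero) cu≡nothing
    ... | inj₁ (_ , refl) | inj₂ cv≡nothing with () ← trans (sym cv≡zero) cv≡nothing
    ... | inj₂ (refl , _) | inj₁ cv≡nothing with () ← trans (sym cv≡zero) cv≡nothing
    ... | inj₂ (_ , refl) | inj₂ cu≡nothing with () ← trans (sym cu≡zero) cu≡nothing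

  module Walk {l} (f : Fin (suc (suc (suc l))) → Fin (n G)) (cyc : IsCycle f) where
    open IsCycle cyc

    edge : Fin (suc (suc l)) → Fin (m G)
    edge i = proj₁ (adj-step i)

    closing : Fin (m G)
    closing = proj₁ adj-close

    -- Bob's walk has coloured f 0, …, f i with zero and he is about to colour f (i + 1).
    record Stage (i : Fin (suc (suc l))) (c : Colouring) : Set where
      field
        root : c (inj₁ (f zero)) ≡ just zero
        reached : c (inj₁ (f (inject₁ i))) ≡ just zero
        ahead : ∀ j → i ≤ j → c (inj₁ (f (suc j))) ≡ nothing
        edgesFree : EdgesFree f c

    Lost : Fin (suc (suc l)) → Set
    Lost i = ∀ c → Stage i c → ¬ AliceWins c bob

    stage-zero : ∀ {c} → Fresh f (f zero) c → Stage zero c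
    stage-zero (root , fresh) = record
      { root = root
      ; reached = root
      ; ahead = λ j _ → fresh _ (suc j , refl) λ eq → 0≢1+n (sym (injective (inj₁-injective eq)))
      ; edgesFree = λ uv joins _ → fresh _ (_ , _ , uv , joins) λ ()
      }

    module BobColoursNext {i c} (stage : Stage i c) where
      open Stage stage

      next : Fin (n G) ⊎ Fin (m G)
      next = inj₁ (f (suc i))

      next-free : c next ≡ nothing
      next-free = ahead i Fin.≤-refl

      after : Colouring
      after = update c next zero

      after-⊒ : c ⊑ after
      after-⊒ = update-⊒ c next zero next-free

      after-edge : ∀ {e} → c (inj₂ e) ≡ nothing → after (inj₂ e) ≡ nothing
      after-edge = trans (update-≢ c next zero λ ())

      threat-behind : Threat after (inj₂ (edge i))
      threat-behind = edgeThreat (proj₂ (adj-step i)) (after-⊒ reached) (update-≡ c next zero)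
        (after-edge (edgesFree (inj₁ (i , refl , refl)) (proj₂ (adj-step i)) (inj₂ next-free)))

    stage-suc : ∀ {j c} (stage : Stage (inject₁ j) c) a → let open BobColoursNext stage in
                Stage (suc j) (update after (inj₂ (edge (inject₁ j))) a)
    stage-suc {j} {c} stage a = record
      { root = answer-⊒ (after-⊒ root)
      ; reached = answer-⊒ (update-≡ c next zero)
      ; ahead = ahead′
      ; edgesFree = edgesFree-edgeMove {f = f} {c = after} a (proj₂ (adj-step (inject₁ j)))
                      (after-⊒ reached) (update-≡ c next zero)
                      (edgesFree-vertexMove {f = f} {c = c} zero next-free edgesFree)
      }
      where
      open Stage stage
      open BobColoursNext stage

      answer : Fin (n G) ⊎ Fin (m G)
      answer = inj₂ (edge (inject₁ j))

      answer-⊒ : after ⊑ update after answer a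
      answer-⊒ = update-⊒ after answer a (proj₁ threat-behind)

      ahead′ : ∀ p → suc j ≤ p → update after answer a (inj₁ (f (suc p))) ≡ nothing
      ahead′ p sj≤p =
        trans (update-≢ after answer a λ ()) (trans (update-≢ c next zero p≢next) (ahead p (ℕ.<⇒≤ j<p)))
        where
        j<p : inject₁ j < p
        j<p = ℕ.<-≤-trans (≤̄⇒inject₁< Fin.≤-refl) sj≤p

        p≢next : inj₁ (f (suc p)) ≢ next
        p≢next eq = <⇒≢ j<p (sym (suc-injective (injective (inj₁-injective eq))))

    advance : ∀ j → Lost (suc j) → Lost (inject₁ j)
    advance j lost c stage wins with answerThreat (winsAfterBobMove wins next-free zero) threat-behind
      where open BobColoursNext stage
    ... | a , wins′ = lost _ (stage-suc stage a) wins′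

    -- The only place where the cycle needs length at least 3.
    lastEdge≢closing : edge (fromℕ (suc l)) ≢ closing
    lastEdge≢closing eq with joins-unique (proj₂ (adj-step (fromℕ (suc l))))
                               (subst (λ e → Joins G e _ _) (sym eq) (proj₂ adj-close))
    ... | inj₁ (last≡ , _) = fromℕ≢inject₁ (injective last≡)
    ... | inj₂ (_ , zero≡) with () ← injective zero≡

    finish : Lost (fromℕ (suc l))
    finish c stage wins =
      ¬wins-doubleThreat (winsAfterBobMove wins next-free zero) (lastEdge≢closing ∘ inj₂-injective)
        threat-behind threat-closing
      where
      open Stage stage
      open BobColoursNext stage

      threat-closing : Threat after (inj₂ closing)
      threat-closing = edgeThreat (proj₂ adj-close) (update-≡ c next zero) (after-⊒ root)
        (after-edge (edgesFree (inj₂ (refl , refl)) (proj₂ adj-close) (inj₁ next-free)))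

    lost : ∀ i → Lost i
    lost = >-weakInduction Lost finish advance

  ¬wins-freshRootedCycle : ∀ {L} → 2 ℕ.≤ L → (f : Fin (suc L) → Fin (n G)) → IsCycle f →
                           ∀ {c} → Fresh f (f zero) c → ¬ AliceWins c bob
  ¬wins-freshRootedCycle (s≤s (s≤s z≤n)) f cyc fresh =
    Walk.lost f cyc zero _ (Walk.stage-zero f cyc fresh)

  ¬wins-freshCycle : (C : Cycle G) → ∀ {w c} → OnCycle C w → Fresh (vtx C) w c → ¬ AliceWins c bob
  ¬wins-freshCycle C (i , refl) (root , fresh) with rerooting (vtx C) (cycle-isCycle C) i
  ... | g , cyc-g , g0≡ , g⊆C = ¬wins-freshRootedCycle (len≥3 C) g cyc-g fresh-g
    where
    fresh-g : Fresh g (g zero) _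
    fresh-g = subst (λ w → Fresh g w _) (sym g0≡) (root , λ x → fresh x ∘ g⊆C x)

  touchesBoth⇒root : ∀ {C D : Cycle G} → EdgeDisjoint C D →
                     ∀ {w} → (∀ x → OnCycle C x → OnCycle D x → x ≡ w) →
                     ∀ {x} → Touches (vtx C) x → Touches (vtx D) x → x ≡ inj₁ w
  touchesBoth⇒root disjoint common {inj₁ x} onC onD = cong inj₁ (common x onC onD)
  touchesBoth⇒root disjoint common {inj₂ e} (u , v , uvC , joinsC) (_ , _ , uvD , joinsD)
    with joins-unique joinsC joinsD
  ... | inj₁ (refl , refl) = contradiction (inj₁ uvD) (disjoint u v uvC)
  ... | inj₂ (refl , refl) = contradiction (inj₂ uvD) (disjoint u v uvC)

  ¬winsB : (C D : Cycle G) → EdgeDisjoint C D → ExactlyOneCommon C D → ¬ AliceWinsB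
  ¬winsB C D disjoint (w , onC , onD , common) winsB
    with winningReply {v = inj₂ (proj₁ (close C))} (winsAfterBobMove {v = inj₁ w} winsB refl zero)
                      (update-≢ empty (inj₁ w) zero {inj₂ (proj₁ (close C))} λ ())
  ... | v , a , cv≡nothing , wins =
    lostIfAvoids C onC λ touchesC → lostIfAvoids D onD λ touchesD →
      contradiction (touchesBoth⇒root {C} {D} disjoint common touchesC touchesD) v≢w
    where
    coloured : Colouring
    coloured = update empty (inj₁ w) zero

    v≢w : v ≢ inj₁ w
    v≢w refl with () ← trans (sym cv≡nothing) (update-≡ empty (inj₁ w) zero)

    lostIfAvoids : (X : Cycle G) → OnCycle X w → ¬ ¬ Touches (vtx X) v
    lostIfAvoids X onX avoids = ¬wins-freshCycle X onX (root , fresh) wins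
      where
      root : update coloured v a (inj₁ w) ≡ just zero
      root = update-⊒ coloured v a cv≡nothing {inj₁ w} (update-≡ empty (inj₁ w) zero)

      fresh : ∀ x → Touches (vtx X) x → x ≢ inj₁ w → update coloured v a x ≡ nothing
      fresh x touches x≢w =
        trans (update-≢ coloured v a {x} λ { refl → avoids touches }) (update-≢ empty (inj₁ w) zero x≢w)

subdivisionVertices : (G : Graph) → List (V (S G))
subdivisionVertices G = map inj₁ (allFin (n G)) ++ map inj₂ (allFin (m G))

∈-subdivisionVertices : ∀ G v → v ∈ subdivisionVertices G
∈-subdivisionVertices G (inj₁ x) = ∈-++⁺ˡ (∈-map⁺ inj₁ (∈-allFin x))
∈-subdivisionVertices G (inj₂ e) = ∈-++⁺ʳ _ (∈-map⁺ inj₂ (∈-allFin e))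

lemma5p6 : (G : Graph) → (C D : Cycle G) →
    EdgeDisjoint C D → ExactlyOneCommon C D → IsDg' (S G) 1
lemma5p6 G C D disjoint common = aliceWins , bobWins
  where
  aliceWins : Game.AliceWinsB (S G) 1
  aliceWins = FiniteGame.aliceWins (S G) 0 (subdivisionVertices G) (∈-subdivisionVertices G)
                (complete⇒allDominating (S G)) _ bob

  bobWins : ∀ k → 1 ℕ.< k → ¬ Game.AliceWinsB (S G) k
  bobWins (suc (suc k)) _ = Attack.¬winsB G k C D disjoint common
  bobWins (suc zero) (s≤s ())
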